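{- For every integer $k \geq 2$, the graph $G_k$ has a heavy cycle $C_1$ (a cycle containing every edge of $A_k$) with $V(C_1) = V(G_k) \setminus \{v_k, z\}$.
   Context: For an integer $k \geq 1$, $G_k := K_k \vee P_{2k+1}$ is the join of a complete graph on vertices $x_1, \ldots, x_k$ with a path on $2k+1$ vertices whose vertices, in order along the path, are $u_1, u_2, \ldots, u_k, z, v_k, v_{k-1}, \ldots, v_1$ (every $x_i$ is adjacent to every path vertex and to every other $x_j$). The set of heavy edges of $G_k$ is $A_k = \{x_iu_i : 1 \leq i \leq k\} \cup \{x_iv_i : 1 \leq i \leq k-1\}$. A cycle of $G_k$ is heavy if it contains every edge of $A_k$. -}

module Defs where

open import Data.Nat using (ℕ; zero; suc; _+_; _*_; _∸_; _≤_)
open import Data.Fin using (Fin; toℕ)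
open import Data.List using (List; []; _∷_; _++_; [_]; zip; length)
open import Data.List.Membership.Propositional using (_∈_)
open import Data.List.Relation.Unary.Unique.Propositional using (Unique)
open import Data.Product using (_×_; _,_; Σ)
open import Data.Sum using (_⊎_)
open import Relation.Binary.PropositionalEquality using (_≡_; _≢_)
open import Relation.Nullary using (¬_)

-- Vertices of G_k = K_k ∨ P_{2k+1}.  Indices are 0-based:
-- x i, u i, v i with i : Fin k stand for x_{i+1}, u_{i+1}, v_{i+1}.
data V (k : ℕ) : Set where
  x : Fin k → V k
  u : Fin k → V k
  v : Fin k → V k
  z : V k

-- Position along the path u_1, …, u_k, z, v_k, …, v_1 (positions 0 … 2k).
data PathPos (k : ℕ) : V k → ℕ → Set where
  pos-u : (i : Fin k) → PathPos k (u i) (toℕ i)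
  pos-z : PathPos k z k
  pos-v : (i : Fin k) → PathPos k (v i) (2 * k ∸ toℕ i)

data Adj (k : ℕ) : V k → V k → Set where
  xx   : (i j : Fin k) → i ≢ j → Adj k (x i) (x j)
  xp   : (i : Fin k) (a : V k) (n : ℕ) → PathPos k a n → Adj k (x i) a
  px   : (i : Fin k) (a : V k) (n : ℕ) → PathPos k a n → Adj k a (x i)
  path : (a b : V k) (n : ℕ) → PathPos k a n → PathPos k b (suc n) → Adj k a b
  path' : (a b : V k) (n : ℕ) → PathPos k a (suc n) → PathPos k b n → Adj k a b

cyclicPairs : {A : Set} → List A → List (A × A)
cyclicPairs [] = []
cyclicPairs (a ∷ as) = zip (a ∷ as) (as ++ [ a ])

record IsCycle (k : ℕ) (C : List (V k)) : Set where
  field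
    len      : 3 ≤ length C
    distinct : Unique C
    adjacent : ∀ a b → (a , b) ∈ cyclicPairs C → Adj k a b

EdgeOf : {k : ℕ} → List (V k) → V k → V k → Set
EdgeOf C a b = ((a , b) ∈ cyclicPairs C) ⊎ ((b , a) ∈ cyclicPairs C)

-- Heavy edges A_k = {x_i u_i : 1 ≤ i ≤ k} ∪ {x_i v_i : 1 ≤ i ≤ k-1}.
-- A cycle is heavy if it contains every edge of A_k.
Heavy : (k : ℕ) → List (V k) → Set
Heavy k C = ((i : Fin k) → EdgeOf C (x i) (u i))
          × ((i : Fin k) → suc (toℕ i) ≢ k → EdgeOf C (x i) (v i))

IsVk : (k : ℕ) → V k → Set
IsVk k w = Σ (Fin k) λ i → (suc (toℕ i) ≡ k) × (w ≡ v i)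

module Submission where

-- The cycle is x_k u_k · u_{k-1} x_{k-1} v_{k-1} · v_{k-2} x_{k-2} u_{k-2} · u_{k-3} … and back
-- to x_k: it zigzags down the levels k-1, …, 1, crossing level i as u_i x_i v_i or
-- v_i x_i u_i, so both heavy edges at level i are cycle edges. Consecutive levels are
-- joined by a path edge on the side where the previous level ended (u_{i+1} u_i or
-- v_{i+1} v_i), the last vertex lies on the path and so is adjacent to x_k, and the
-- heavy edge at level k is x_k u_k.

open import Defs
open import Data.Bool using (Bool; true; false; not)
open import Data.Empty using (⊥-elim)
open import Data.Fin using (Fin; toℕ; fromℕ; fromℕ<)
open import Data.Fin.Properties using (toℕ-fromℕ<; toℕ-fromℕ; toℕ-injective; toℕ<n)
open import Data.List using (List; []; _∷_; _++_; [_]; zip; length)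
open import Data.List.Membership.Propositional using (_∈_; _∉_)
open import Data.List.Membership.Propositional.Properties using (∈-++⁻; ∈-++⁺ˡ; ∈-++⁺ʳ)
open import Data.List.Relation.Unary.Any using (here; there)
open import Data.List.Relation.Unary.All.Properties using (¬Any⇒All¬)
open import Data.List.Relation.Unary.All using ([]; _∷_)
open import Data.List.Relation.Unary.AllPairs using ([]; _∷_)
open import Data.List.Relation.Unary.Linked using (Linked; [-]; _∷_)
open import Data.List.Relation.Unary.Unique.Propositional using (Unique)
import Data.List.Relation.Unary.Unique.Propositional.Properties as Unique
open import Data.Nat using (ℕ; zero; suc; _*_; _∸_; _≤_; _<_; s≤s; z≤n)
open import Data.Nat.Properties
  using (≤-trans; ≤-reflexive; <⇒≤; <⇒≱; m≤m+n; m≤n⇒m≤1+n; m≤n⇒m<n∨m≡n; m<1+n⇒m≤n; m<1+n⇒m<n∨m≡n; n≤0⇒n≡0; n≤1+n; +-∸-assoc)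
open import Data.Product using (Σ; _×_; _,_)
open import Data.Sum using (_⊎_; inj₁; inj₂)
import Data.Sum as Sum
open import Function.Bundles using (_⇔_; mk⇔)
open import Relation.Binary.PropositionalEquality using (_≡_; _≢_; refl; sym; trans; subst; cong)
open import Relation.Nullary using (¬_)

module _ {A : Set} where

  pairs : List A → List (A × A)
  pairs []          = []
  pairs (a ∷ [])    = []
  pairs (a ∷ b ∷ l) = (a , b) ∷ pairs (b ∷ l)

  PathEdge : List A → A → A → Set
  PathEdge l a b = ((a , b) ∈ pairs l) ⊎ ((b , a) ∈ pairs l)

  ∈-pairs-++⁺ˡ : ∀ {p} l {r} → p ∈ pairs l → p ∈ pairs (l ++ r)
  ∈-pairs-++⁺ˡ (a ∷ b ∷ l) (here eq) = here eq
  ∈-pairs-++⁺ˡ (a ∷ b ∷ l) (there q) = there (∈-pairs-++⁺ˡ (b ∷ l) q)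

  ∈-pairs-∷⁺ : ∀ {p a} l → p ∈ pairs l → p ∈ pairs (a ∷ l)
  ∈-pairs-∷⁺ (b ∷ l) q = there q

  ∈-pairs-++⁺ʳ : ∀ {p} l {r} → p ∈ pairs r → p ∈ pairs (l ++ r)
  ∈-pairs-++⁺ʳ []      q = q
  ∈-pairs-++⁺ʳ (a ∷ l) q = ∈-pairs-∷⁺ (l ++ _) (∈-pairs-++⁺ʳ l q)

  PathEdge-++⁺ˡ : ∀ l {r a b} → PathEdge l a b → PathEdge (l ++ r) a b
  PathEdge-++⁺ˡ l = Sum.map (∈-pairs-++⁺ˡ l) (∈-pairs-++⁺ˡ l)

  PathEdge-++⁺ʳ : ∀ l {r a b} → PathEdge r a b → PathEdge (l ++ r) a b
  PathEdge-++⁺ʳ l = Sum.map (∈-pairs-++⁺ʳ l) (∈-pairs-++⁺ʳ l)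

  zip-∷-++≡pairs : ∀ a l c → zip (a ∷ l) (l ++ [ c ]) ≡ pairs (a ∷ l ++ [ c ])
  zip-∷-++≡pairs a []      c = refl
  zip-∷-++≡pairs a (b ∷ l) c = cong ((a , b) ∷_) (zip-∷-++≡pairs b l c)

  cyclicPairs≡pairs : ∀ a l → cyclicPairs (a ∷ l) ≡ pairs (a ∷ l ++ [ a ])
  cyclicPairs≡pairs a l = zip-∷-++≡pairs a l a

  ∈pairs⇒∈cyclicPairs : ∀ {p} a l → p ∈ pairs l → p ∈ cyclicPairs (a ∷ l)
  ∈pairs⇒∈cyclicPairs a l q =
    subst (_ ∈_) (sym (cyclicPairs≡pairs a l)) (∈-pairs-∷⁺ (l ++ [ a ]) (∈-pairs-++⁺ˡ l q))

  Linked⇒∈pairs : ∀ {R : A → A → Set} {l a b} → Linked R l → (a , b) ∈ pairs l → R a b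
  Linked⇒∈pairs (r ∷ rs) (here refl) = r
  Linked⇒∈pairs (r ∷ rs) (there q)   = Linked⇒∈pairs rs q

module _ {k : ℕ} where

  PathEdge⇒EdgeOf : ∀ {a : V k} {l b c} → PathEdge l b c → EdgeOf (a ∷ l) b c
  PathEdge⇒EdgeOf {a} {l} = Sum.map (∈pairs⇒∈cyclicPairs a l) (∈pairs⇒∈cyclicPairs a l)

  -- z gets level k, which no index attains.
  level : V k → ℕ
  level (x i) = toℕ i
  level (u i) = toℕ i
  level (v i) = toℕ i
  level z     = k

  side : Bool → Fin k → V k
  side true  = u
  side false = v

  level-side : ∀ b i → level (side b i) ≡ toℕ i
  level-side true  i = refl
  level-side false i = refl

  side-x : ∀ b i j → Adj k (side b i) (x j)
  side-x true  i j = px j (u i) _ (pos-u i)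
  side-x false i j = px j (v i) _ (pos-v i)

  x-side : ∀ b i j → Adj k (x j) (side b i)
  x-side true  i j = xp j (u i) _ (pos-u i)
  x-side false i j = xp j (v i) _ (pos-v i)

  side-adj : ∀ b {i j : Fin k} → toℕ i ≡ suc (toℕ j) → Adj k (side b i) (side b j)
  side-adj true  {i} {j} i≡1+j =
    path' (u i) (u j) (toℕ j) (subst (PathPos k (u i)) i≡1+j (pos-u i)) (pos-u j)
  side-adj false {i} {j} i≡1+j =
    path (v i) (v j) (2 * k ∸ toℕ i) (pos-v i) (subst (PathPos k (v j)) pos≡ (pos-v j))
    where
    1+j≤2k : suc (toℕ j) ≤ 2 * k
    1+j≤2k = subst (_≤ 2 * k) i≡1+j (≤-trans (<⇒≤ (toℕ<n i)) (m≤m+n k _))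
    pos≡ : 2 * k ∸ toℕ j ≡ suc (2 * k ∸ toℕ i)
    pos≡ rewrite i≡1+j = +-∸-assoc 1 1+j≤2k

  block : Bool → Fin k → List (V k)
  block b i = side b i ∷ x i ∷ side (not b) i ∷ []

  zigzag : Bool → (n : ℕ) → n < k → List (V k)
  zigzag b zero    n<k = block b (fromℕ< n<k)
  zigzag b (suc n) n<k = block b (fromℕ< n<k) ++ zigzag (not b) n (<⇒≤ n<k)

  zigzag-nonempty : ∀ b n n<k → 1 ≤ length (zigzag b n n<k)
  zigzag-nonempty b zero    n<k = s≤s z≤n
  zigzag-nonempty b (suc n) n<k = s≤s z≤n

  zigzag-linked : ∀ b n n<k {s} j → Adj k s (side b (fromℕ< n<k)) →
                  Linked (Adj k) (s ∷ zigzag b n n<k ++ [ x j ])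
  zigzag-linked b zero n<k j s-adj =
    s-adj ∷ side-x b _ _ ∷ x-side (not b) _ _ ∷ side-x (not b) _ j ∷ [-]
  zigzag-linked b (suc n) n<k j s-adj =
    s-adj ∷ side-x b _ _ ∷ x-side (not b) _ _ ∷ zigzag-linked (not b) n _ j (side-adj (not b) consecutive)
    where
    consecutive : toℕ (fromℕ< n<k) ≡ suc (toℕ (fromℕ< (<⇒≤ n<k)))
    consecutive = trans (toℕ-fromℕ< n<k) (cong suc (sym (toℕ-fromℕ< (<⇒≤ n<k))))

  ∈-block⁻ : ∀ {w} b i → w ∈ block b i → level w ≡ toℕ i
  ∈-block⁻ b i (here refl)                 = level-side b i
  ∈-block⁻ b i (there (here refl))         = refl
  ∈-block⁻ b i (there (there (here refl))) = level-side (not b) i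

  side∈block : ∀ b c i → side c i ∈ block b i
  side∈block true  true  i = here refl
  side∈block true  false i = there (there (here refl))
  side∈block false true  i = there (there (here refl))
  side∈block false false i = here refl

  ∈-block⁺ : ∀ b i w → level w ≡ toℕ i → w ∈ block b i
  ∈-block⁺ b i (x j) j≡i with toℕ-injective j≡i
  ... | refl = there (here refl)
  ∈-block⁺ b i (u j) j≡i with toℕ-injective j≡i
  ... | refl = side∈block b true i
  ∈-block⁺ b i (v j) j≡i with toℕ-injective j≡i
  ... | refl = side∈block b false i
  ∈-block⁺ b i z k≡i = ⊥-elim (<⇒≱ (toℕ<n i) (≤-reflexive k≡i))

  ∈-zigzag⁻ : ∀ {w} b n n<k → w ∈ zigzag b n n<k → level w ≤ n
  ∈-zigzag⁻ b zero n<k q = ≤-reflexive (trans (∈-block⁻ b _ q) (toℕ-fromℕ< n<k))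
  ∈-zigzag⁻ b (suc n) n<k q with ∈-++⁻ (block b (fromℕ< n<k)) q
  ... | inj₁ q′ = ≤-reflexive (trans (∈-block⁻ b _ q′) (toℕ-fromℕ< n<k))
  ... | inj₂ q′ = m≤n⇒m≤1+n (∈-zigzag⁻ (not b) n _ q′)

  ∈-zigzag⁺ : ∀ b n n<k w → level w ≤ n → w ∈ zigzag b n n<k
  ∈-zigzag⁺ b zero n<k w w≤0 =
    ∈-block⁺ b _ w (trans (n≤0⇒n≡0 w≤0) (sym (toℕ-fromℕ< n<k)))
  ∈-zigzag⁺ b (suc n) n<k w w≤1+n with m≤n⇒m<n∨m≡n w≤1+n
  ... | inj₁ w≤n = ∈-++⁺ʳ (block b _) (∈-zigzag⁺ (not b) n _ w (m<1+n⇒m≤n w≤n))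
  ... | inj₂ w≡1+n = ∈-++⁺ˡ (∈-block⁺ b _ w (trans w≡1+n (sym (toℕ-fromℕ< n<k))))

  ∉-zigzag : ∀ {w} b n n<k → n < level w → w ∉ zigzag b n n<k
  ∉-zigzag b n n<k n<w q = <⇒≱ n<w (∈-zigzag⁻ b n n<k q)

  block-unique : ∀ b i → Unique (block b i)
  block-unique true  i = ((λ ()) ∷ (λ ()) ∷ []) ∷ ((λ ()) ∷ []) ∷ [] ∷ []
  block-unique false i = ((λ ()) ∷ (λ ()) ∷ []) ∷ ((λ ()) ∷ []) ∷ [] ∷ []

  zigzag-unique : ∀ b n n<k → Unique (zigzag b n n<k)
  zigzag-unique b zero    n<k = block-unique b _
  zigzag-unique b (suc n) n<k =
    Unique.++⁺ (block-unique b _) (zigzag-unique (not b) n _) disjoint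
    where
    disjoint : ∀ {w} → ¬ (w ∈ block b (fromℕ< n<k) × w ∈ zigzag (not b) n _)
    disjoint (q , q′) = ∉-zigzag (not b) n _
      (≤-reflexive (sym (trans (∈-block⁻ b _ q) (toℕ-fromℕ< n<k)))) q′

  block-heavy : ∀ b c i → PathEdge (block b i) (x i) (side c i)
  block-heavy true  true  i = inj₂ (here refl)
  block-heavy true  false i = inj₁ (there (here refl))
  block-heavy false true  i = inj₁ (there (here refl))
  block-heavy false false i = inj₂ (here refl)

  zigzag-heavy : ∀ b n n<k c i → toℕ i ≤ n → PathEdge (zigzag b n n<k) (x i) (side c i)
  zigzag-heavy b zero n<k c i i≤0
    with toℕ-injective (trans (n≤0⇒n≡0 i≤0) (sym (toℕ-fromℕ< n<k)))
  ... | refl = block-heavy b c i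
  zigzag-heavy b (suc n) n<k c i i≤1+n with m≤n⇒m<n∨m≡n i≤1+n
  ... | inj₁ i≤n = PathEdge-++⁺ʳ (block b _) (zigzag-heavy (not b) n _ c i (m<1+n⇒m≤n i≤n))
  ... | inj₂ i≡1+n with toℕ-injective (trans i≡1+n (sym (toℕ-fromℕ< n<k)))
  ...   | refl = PathEdge-++⁺ˡ (block b i) (block-heavy b c i)

module _ (m : ℕ) where

  top : Fin (suc (suc m))
  top = fromℕ (suc m)

  m<top : m < toℕ top
  m<top = ≤-reflexive (sym (toℕ-fromℕ (suc m)))

  below-or-top : (i : Fin (suc (suc m))) → toℕ i ≤ m ⊎ i ≡ top
  below-or-top i with m<1+n⇒m<n∨m≡n (toℕ<n i)
  ... | inj₁ i≤m = inj₁ (m<1+n⇒m≤n i≤m)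
  ... | inj₂ i≡1+m = inj₂ (toℕ-injective (trans i≡1+m (sym (toℕ-fromℕ (suc m)))))

  m<2+m : m < suc (suc m)
  m<2+m = n≤1+n (suc m)

  below : List (V (suc (suc m)))
  below = zigzag true m m<2+m

  cycle₁ : List (V (suc (suc m)))
  cycle₁ = x top ∷ u top ∷ below

  cycle₁-isCycle : IsCycle (suc (suc m)) cycle₁
  cycle₁-isCycle = record
    { len      = s≤s (s≤s (zigzag-nonempty true m m<2+m))
    ; distinct = ¬Any⇒All¬ (u top ∷ below) x-top∉ ∷ ¬Any⇒All¬ below u-top∉ ∷ zigzag-unique true m m<2+m
    ; adjacent = λ a b q →
        Linked⇒∈pairs closed-walk (subst ((a , b) ∈_) (cyclicPairs≡pairs (x top) (u top ∷ below)) q)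
    }
    where
    x-top∉ : x top ∉ u top ∷ below
    x-top∉ (there q) = ∉-zigzag true m m<2+m m<top q
    u-top∉ : u top ∉ below
    u-top∉ = ∉-zigzag true m m<2+m m<top
    top≡1+m : toℕ top ≡ suc (toℕ (fromℕ< m<2+m))
    top≡1+m = trans (toℕ-fromℕ (suc m)) (cong suc (sym (toℕ-fromℕ< m<2+m)))
    closed-walk : Linked (Adj (suc (suc m))) (cycle₁ ++ [ x top ])
    closed-walk = x-side true top top ∷ zigzag-linked true m m<2+m top (side-adj true top≡1+m)

  cycle₁-heavy : Heavy (suc (suc m)) cycle₁
  cycle₁-heavy = x-u , x-v
    where
    heavy-below : ∀ c i → toℕ i ≤ m → EdgeOf cycle₁ (x i) (side c i)
    heavy-below c i i≤m =
      PathEdge⇒EdgeOf (PathEdge-++⁺ʳ [ u top ] (zigzag-heavy true m m<2+m c i i≤m))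
    x-u : ∀ i → EdgeOf cycle₁ (x i) (u i)
    x-u i with below-or-top i
    ... | inj₁ i≤m = heavy-below true i i≤m
    ... | inj₂ refl = inj₁ (here refl)
    x-v : ∀ i → suc (toℕ i) ≢ suc (suc m) → EdgeOf cycle₁ (x i) (v i)
    x-v i not-vk with below-or-top i
    ... | inj₁ i≤m = heavy-below false i i≤m
    ... | inj₂ refl = ⊥-elim (not-vk (cong suc (toℕ-fromℕ (suc m))))

  below⇒¬IsVk×≢z : ∀ {w} → level w ≤ m → ¬ IsVk (suc (suc m)) w × w ≢ z
  below⇒¬IsVk×≢z w≤m = (λ { (i , i≡top , refl) → <⇒≱ (s≤s (s≤s w≤m)) (≤-reflexive (sym i≡top)) })
                     , (λ { refl → <⇒≱ m<2+m w≤m })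

  ∈-cycle₁⁻ : ∀ {w} → w ∈ cycle₁ → ¬ IsVk (suc (suc m)) w × w ≢ z
  ∈-cycle₁⁻ (here refl)         = (λ { (_ , _ , ()) }) , (λ ())
  ∈-cycle₁⁻ (there (here refl)) = (λ { (_ , _ , ()) }) , (λ ())
  ∈-cycle₁⁻ (there (there q))   = below⇒¬IsVk×≢z (∈-zigzag⁻ true m m<2+m q)

  ∈-cycle₁⁺ : ∀ w → ¬ IsVk (suc (suc m)) w × w ≢ z → w ∈ cycle₁
  ∈-cycle₁⁺ (x i) _ with below-or-top i
  ... | inj₁ i≤m = there (there (∈-zigzag⁺ true m m<2+m (x i) i≤m))
  ... | inj₂ refl = here refl
  ∈-cycle₁⁺ (u i) _ with below-or-top i
  ... | inj₁ i≤m = there (there (∈-zigzag⁺ true m m<2+m (u i) i≤m))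
  ... | inj₂ refl = there (here refl)
  ∈-cycle₁⁺ (v i) (not-vk , _) with below-or-top i
  ... | inj₁ i≤m = there (there (∈-zigzag⁺ true m m<2+m (v i) i≤m))
  ... | inj₂ refl = ⊥-elim (not-vk (top , cong suc (toℕ-fromℕ (suc m)) , refl))
  ∈-cycle₁⁺ z (_ , z≢z) = ⊥-elim (z≢z refl)

lemma2p4 : (k : ℕ) → 2 ≤ k →
    Σ (List (V k)) λ C₁ → IsCycle k C₁ × Heavy k C₁ ×
      ((w : V k) → (w ∈ C₁) ⇔ ((¬ IsVk k w) × (w ≢ z)))
lemma2p4 (suc (suc m)) (s≤s (s≤s z≤n)) =
  cycle₁ m , cycle₁-isCycle m , cycle₁-heavy m , λ w → mk⇔ (∈-cycle₁⁻ m) (∈-cycle₁⁺ m w)
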